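{- Let $S$ be as in the context and let $U$ be the subspace of $F_2^n$ spanned by $\Pi$. Then $U$ is a $\mathbf W$-submodule of $F_2^n$, i.e. $\mathbf gU\subseteq U$ for all $\mathbf g\in\mathbf W$.
   Context: $S$ is a finite simple connected graph with vertex set $\{s_1,\dots,s_n\}$, $n\ge2$, and edge set $R$, such that $s_1,\dots,s_{n-1}$ is an induced path; $s_n$ is adjacent to some of $s_1,\dots,s_{n-1}$. $\widetilde s$ is the characteristic vector in $F_2^n$ (coordinates indexed by vertices) of vertex $s$. The flipping move of $s$ is $\mathbf s\in\mathrm{Mat}_n(F_2)$ with $\mathbf s_{ab}=1$ if $a=b$, or if $b=s$ and $ab\in R$, and $0$ otherwise. $\mathbf W$ is the subgroup of $\mathrm{GL}_n(F_2)$ generated by $\mathbf{s_1},\dots,\mathbf{s_n}$, acting on $F_2^n$ by left multiplication. $\overline1=\widetilde s_1$, $\overline{i+1}=\mathbf{s_i}\cdots\mathbf{s_1}\overline1$ for $1\le i\le n-1$, and $\Pi=\{\overline1,\dots,\overline n\}$. -}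

module Defs where

open import Data.Bool using (Bool; true; false; _∧_; _xor_; if_then_else_)
open import Data.Nat using (ℕ; zero; suc; _<_; _≤_; _∸_; _≡ᵇ_)
open import Data.Fin using (Fin; toℕ; _≟_)
open import Data.Fin.Properties using ()
open import Data.List using (List; []; _∷_; foldr; foldl; map; filter; allFin)
open import Data.Product using (Σ; _×_; _,_; ∃)
open import Data.Sum using (_⊎_)
open import Relation.Nullary.Decidable using (⌊_⌋)
open import Relation.Binary.PropositionalEquality using (_≡_)
open import Data.Nat.Properties using (_<?_)

-- Linear algebra over F₂ = Bool (xor = +, ∧ = ·), vectors and matrices
-- indexed by the vertex set Fin n.

Vec₂ : ℕ → Set
Vec₂ n = Fin n → Bool

Mat₂ : ℕ → Set
Mat₂ n = Fin n → Fin n → Bool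

Σ₂ : ∀ {n} → (Fin n → Bool) → Bool
Σ₂ {n} f = foldr _xor_ false (map f (allFin n))

_≈ᵥ_ : ∀ {n} → Vec₂ n → Vec₂ n → Set
u ≈ᵥ v = ∀ a → u a ≡ v a

_≈ₘ_ : ∀ {n} → Mat₂ n → Mat₂ n → Set
A ≈ₘ B = ∀ a b → A a b ≡ B a b

_⊗_ : ∀ {n} → Mat₂ n → Mat₂ n → Mat₂ n
(A ⊗ B) a c = Σ₂ (λ b → A a b ∧ B b c)

_·_ : ∀ {n} → Mat₂ n → Vec₂ n → Vec₂ n
(A · v) a = Σ₂ (λ b → A a b ∧ v b)

idM : ∀ {n} → Mat₂ n
idM a b = ⌊ a ≟ b ⌋

-- Graphs on vertex set Fin n (vertex s_{i+1} is the element with toℕ = i)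

record Graph (n : ℕ) : Set where
  field
    adj   : Fin n → Fin n → Bool
    sym   : ∀ a b → adj a b ≡ adj b a
    irrefl : ∀ a → adj a a ≡ false
open Graph public

data Walk {n} (G : Graph n) : Fin n → Fin n → Set where
  here : ∀ a → Walk G a a
  step : ∀ {a b c} → adj G a b ≡ true → Walk G b c → Walk G a c

Connected : ∀ {n} → Graph n → Set
Connected G = ∀ a b → Walk G a b

InducedPathPrefix : ∀ {n} → Graph n → Set
InducedPathPrefix {n} G =
  ∀ a b → toℕ a < n ∸ 1 → toℕ b < n ∸ 1 →
    (adj G a b ≡ true → (toℕ a ≡ suc (toℕ b) ⊎ toℕ b ≡ suc (toℕ a))) ×
    ((toℕ a ≡ suc (toℕ b) ⊎ toℕ b ≡ suc (toℕ a)) → adj G a b ≡ true)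

chr : ∀ {n} → Fin n → Vec₂ n
chr s b = ⌊ b ≟ s ⌋

flipM : ∀ {n} → Graph n → Fin n → Mat₂ n
flipM G s a b = if ⌊ a ≟ b ⌋ then true else (⌊ b ≟ s ⌋ ∧ adj G a b)

-- W = subgroup of GL_n(F₂) generated by the flipping moves:
-- the smallest set of matrices containing the identity and the
-- generators, closed under products and inverses.
data InW {n} (G : Graph n) : Mat₂ n → Set where
  w-id  : InW G idM
  w-gen : ∀ s → InW G (flipM G s)
  w-mul : ∀ {g h} → InW G g → InW G h → InW G (g ⊗ h)
  w-inv : ∀ {g h} → InW G g → (h ⊗ g) ≈ₘ idM → (g ⊗ h) ≈ₘ idM → InW G h

bar1 : ∀ {n} → Vec₂ n
bar1 b = toℕ b ≡ᵇ 0

-- Πvec G k (k with toℕ k = i) is \overline{i+1} = 𝐬_i ⋯ 𝐬_1 \bar 1 :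
-- apply 𝐬_1, then 𝐬_2, …, up to 𝐬_i (the vertices with toℕ < i).
Πvec : ∀ {n} → Graph n → Fin n → Vec₂ n
Πvec {n} G k =
  foldl (λ v j → flipM G j · v) bar1
        (filter (λ j → toℕ j <? toℕ k) (allFin n))

InSpanΠ : ∀ {n} → Graph n → Vec₂ n → Set
InSpanΠ G v = ∃ λ (c : Fin _ → Bool) → v ≈ᵥ (λ a → Σ₂ (λ k → c k ∧ Πvec G k a))

-- The span U of Π is W-stable as soon as every flipping move maps U into U,
-- because each flipping move is an involution.  Since 𝐬 v = v + v_s N(s), where
-- N(s) is the characteristic vector of the neighbourhood of s, it suffices to
-- show N(s) ∈ U for every vertex s.  On the path, \overline{r+1} equals
-- s̃_r + s̃_{r+1} (with s̃_0 = s̃_n = 0) up to its s_n-coordinate d_r, so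
-- N(s_{r+1}) = \overline{r+1} + \overline{r+2}.  For N(s_n), s_n being the apex,
-- combine the prefix sums F_r = \overline 1 + ⋯ + \overline{r+1}, whose path
-- part is s̃_{r+1}, with the coefficients c_r = d_r + d_{r+1} of N(s_n) on the
-- path: the s_n-coordinate of this combination is (1 + d_r)(d_0 + ⋯ + d_{r-1}),
-- and when it is 1 the vector s̃_n = F_{n-1} itself lies in U.
module Submission where

open import Data.Bool using (Bool; true; false; _∧_; _xor_; not)
open import Data.Bool.Properties
  using (xor-same; xor-identityʳ; ∧-distribˡ-xor; ∧-distribʳ-xor; ∧-comm; ∧-assoc; ∧-zeroʳ; ∧-identityʳ; T-≡)
open import Data.Bool.Solver using (module xor-∧-Solver)
open import Data.Fin using (Fin; zero; suc; toℕ; fromℕ; fromℕ<; _≟_)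
open import Data.Fin.Properties using (toℕ-injective; toℕ<n; toℕ-fromℕ; toℕ-fromℕ<)
open import Data.List using (List; []; _∷_; _∷ʳ_; foldr; foldl; map; filter; allFin)
open import Data.List.Properties using (foldl-∷ʳ; map-tabulate; map-++; filter-none)
open import Data.List.Relation.Unary.All.Properties using (tabulate⁺)
open import Data.Nat using (ℕ; zero; suc; _<_; _≤_; _≡ᵇ_; _<ᵇ_; s≤s; s≤s⁻¹)
import Data.Nat.Properties as ℕ
open import Data.Nat.Properties using (_<?_; <⇒≤; ≤-refl; ≤-reflexive; <-asym; <⇒≢; <⇒<ᵇ; m<n⇒m<1+n; m≤n⇒m<n∨m≡n)
open import Data.Empty using (⊥-elim)
open import Data.Product using (∃; _×_; _,_)
open import Data.Sum using (_⊎_; inj₁; inj₂)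
open import Function using (_∘_; id)
open import Function.Bundles using (Equivalence)
open import Relation.Binary.Definitions using (_Respects_)
open import Relation.Binary.PropositionalEquality
open import Relation.Nullary.Decidable using (⌊_⌋; yes; no; dec-true; dec-false)
open import Relation.Nullary.Negation using (¬_)

open import Defs hiding (sym)

open xor-∧-Solver using (solve; _:+_; _:=_)

xor-cancelˡ : ∀ x y → x xor (x xor y) ≡ y
xor-cancelˡ = solve 2 (λ x y → x :+ (x :+ y) := y) refl

xor-cancelʳ : ∀ x y → (x xor y) xor y ≡ x
xor-cancelʳ = solve 2 (λ x y → (x :+ y) :+ y := x) refl

xor-interchange : ∀ w x y z → (w xor x) xor (y xor z) ≡ (w xor y) xor (x xor z)
xor-interchange = solve 4 (λ w x y z → (w :+ x) :+ (y :+ z) := (w :+ y) :+ (x :+ z)) refl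

≡ᵇ-true : ∀ {x y} → x ≡ y → (x ≡ᵇ y) ≡ true
≡ᵇ-true {x} {y} = dec-true (x ℕ.≟ y)

≡ᵇ-false : ∀ {x y} → x ≢ y → (x ≡ᵇ y) ≡ false
≡ᵇ-false {x} {y} = dec-false (x ℕ.≟ y)

<ᵇ-true : ∀ {x y} → x < y → (x <ᵇ y) ≡ true
<ᵇ-true = Equivalence.to T-≡ ∘ <⇒<ᵇ

≟-comm : ∀ {n} (a b : Fin n) → ⌊ a ≟ b ⌋ ≡ ⌊ b ≟ a ⌋
≟-comm a b with a ≟ b | b ≟ a
... | yes _   | yes _   = refl
... | no  _   | no  _   = refl
... | yes a≡b | no  b≢a = ⊥-elim (b≢a (sym a≡b))
... | no  a≢b | yes b≡a = ⊥-elim (a≢b (sym b≡a))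

xorSum : ∀ {A : Set} → List A → (A → Bool) → Bool
xorSum xs f = foldr _xor_ false (map f xs)

module _ {A : Set} where

  xorSum-cong : ∀ (xs : List A) {f g : A → Bool} → (∀ x → f x ≡ g x) → xorSum xs f ≡ xorSum xs g
  xorSum-cong []       f≗g = refl
  xorSum-cong (x ∷ xs) f≗g = cong₂ _xor_ (f≗g x) (xorSum-cong xs f≗g)

  xorSum-false : ∀ (xs : List A) → xorSum xs (λ _ → false) ≡ false
  xorSum-false []       = refl
  xorSum-false (x ∷ xs) = xorSum-false xs

  xorSum-xor : ∀ (xs : List A) (f g : A → Bool) → xorSum xs (λ x → f x xor g x) ≡ xorSum xs f xor xorSum xs g
  xorSum-xor []       f g = refl
  xorSum-xor (x ∷ xs) f g =
    trans (cong ((f x xor g x) xor_) (xorSum-xor xs f g)) (xor-interchange (f x) (g x) _ _)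

  ∧-distribˡ-xorSum : ∀ b (xs : List A) (f : A → Bool) → b ∧ xorSum xs f ≡ xorSum xs (λ x → b ∧ f x)
  ∧-distribˡ-xorSum b []       f = ∧-zeroʳ b
  ∧-distribˡ-xorSum b (x ∷ xs) f =
    trans (∧-distribˡ-xor b (f x) _) (cong ((b ∧ f x) xor_) (∧-distribˡ-xorSum b xs f))

  ∧-distribʳ-xorSum : ∀ b (xs : List A) (f : A → Bool) → xorSum xs f ∧ b ≡ xorSum xs (λ x → f x ∧ b)
  ∧-distribʳ-xorSum b []       f = refl
  ∧-distribʳ-xorSum b (x ∷ xs) f =
    trans (∧-distribʳ-xor b (f x) _) (cong ((f x ∧ b) xor_) (∧-distribʳ-xorSum b xs f))

xorSum-comm : ∀ {A B : Set} (xs : List A) (ys : List B) (f : A → B → Bool) →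
  xorSum xs (λ x → xorSum ys (f x)) ≡ xorSum ys (λ y → xorSum xs (λ x → f x y))
xorSum-comm []       ys f = sym (xorSum-false ys)
xorSum-comm (x ∷ xs) ys f =
  trans (cong (xorSum ys (f x) xor_) (xorSum-comm xs ys f))
        (sym (xorSum-xor ys (f x) (λ y → xorSum xs (λ x′ → f x′ y))))

Σ₂-suc : ∀ {n} (g : Fin (suc n) → Bool) → Σ₂ g ≡ g zero xor Σ₂ (g ∘ suc)
Σ₂-suc g = cong (λ xs → g zero xor foldr _xor_ false xs)
  (trans (map-tabulate suc g) (sym (map-tabulate id (g ∘ suc))))

chr-suc : ∀ {n} (s b : Fin n) → chr (suc s) (suc b) ≡ chr s b
chr-suc s b with b ≟ s
... | yes _ = refl
... | no  _ = refl

Σ₂-chr : ∀ {n} (s : Fin n) (f : Fin n → Bool) → Σ₂ (λ b → chr s b ∧ f b) ≡ f s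
Σ₂-chr {suc n} zero f =
  trans (Σ₂-suc (λ b → chr zero b ∧ f b))
        (trans (cong (f zero xor_) (xorSum-false (allFin n))) (xor-identityʳ (f zero)))
Σ₂-chr {suc n} (suc s) f =
  trans (Σ₂-suc (λ b → chr (suc s) b ∧ f b))
        (trans (xorSum-cong (allFin n) (λ b → cong (_∧ f (suc b)) (chr-suc s b))) (Σ₂-chr s (f ∘ suc)))

infixl 25 _⊕_
infixr 26 _∧ᵥ_

0ᵥ : ∀ {n} → Vec₂ n
0ᵥ _ = false

_⊕_ : ∀ {n} → Vec₂ n → Vec₂ n → Vec₂ n
(u ⊕ v) a = u a xor v a

_∧ᵥ_ : ∀ {n} → Bool → Vec₂ n → Vec₂ n
(b ∧ᵥ v) a = b ∧ v a

≈ᵥ-sym : ∀ {n} {u v : Vec₂ n} → u ≈ᵥ v → v ≈ᵥ u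
≈ᵥ-sym u≈v a = sym (u≈v a)

nbhd : ∀ {n} → Graph n → Fin n → Vec₂ n
nbhd G s a = adj G a s

module _ {n : ℕ} where

  ·-cong : (M : Mat₂ n) {u v : Vec₂ n} → u ≈ᵥ v → (M · u) ≈ᵥ (M · v)
  ·-cong M u≈v a = xorSum-cong (allFin n) (λ b → cong (M a b ∧_) (u≈v b))

  ·-congˡ : {M N : Mat₂ n} → M ≈ₘ N → (v : Vec₂ n) → (M · v) ≈ᵥ (N · v)
  ·-congˡ M≈N v a = xorSum-cong (allFin n) (λ b → cong (_∧ v b) (M≈N a b))

  ⊗-· : (M N : Mat₂ n) (v : Vec₂ n) → ((M ⊗ N) · v) ≈ᵥ (M · (N · v))
  ⊗-· M N v a = begin
      xorSum L (λ c → xorSum L (λ b → M a b ∧ N b c) ∧ v c)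
    ≡⟨ xorSum-cong L (λ c → ∧-distribʳ-xorSum (v c) L (λ b → M a b ∧ N b c)) ⟩
      xorSum L (λ c → xorSum L (λ b → (M a b ∧ N b c) ∧ v c))
    ≡⟨ xorSum-comm L L (λ c b → (M a b ∧ N b c) ∧ v c) ⟩
      xorSum L (λ b → xorSum L (λ c → (M a b ∧ N b c) ∧ v c))
    ≡⟨ xorSum-cong L (λ b → trans (xorSum-cong L (λ c → ∧-assoc (M a b) (N b c) (v c)))
                                 (sym (∧-distribˡ-xorSum (M a b) L (λ c → N b c ∧ v c)))) ⟩
      xorSum L (λ b → M a b ∧ xorSum L (λ c → N b c ∧ v c))
    ∎
    where
    open ≡-Reasoning
    L = allFin n

  idM-· : (v : Vec₂ n) → (idM · v) ≈ᵥ v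
  idM-· v a = trans (xorSum-cong (allFin n) (λ b → cong (_∧ v b) (≟-comm a b))) (Σ₂-chr a v)

  left-inverse-· : {M N : Mat₂ n} → (M ⊗ N) ≈ₘ idM → (v : Vec₂ n) → (M · (N · v)) ≈ᵥ v
  left-inverse-· {M} {N} MN≈1 v a = trans (sym (⊗-· M N v a)) (trans (·-congˡ MN≈1 v a) (idM-· v a))

  flipM-entry : (G : Graph n) (s a b : Fin n) → flipM G s a b ≡ idM a b xor (chr s b ∧ adj G a b)
  flipM-entry G s a b with a ≟ b
  ... | yes refl = cong (true xor_) (trans (sym (∧-zeroʳ (chr s a))) (cong (chr s a ∧_) (sym (irrefl G a))))
  ... | no  _    = refl

  flipM-· : (G : Graph n) (s : Fin n) (v : Vec₂ n) → (flipM G s · v) ≈ᵥ v ⊕ v s ∧ᵥ nbhd G s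
  flipM-· G s v a = begin
      xorSum L (λ b → flipM G s a b ∧ v b)
    ≡⟨ xorSum-cong L (λ b → trans (cong (_∧ v b) (flipM-entry G s a b))
                                  (∧-distribʳ-xor (v b) (idM a b) (chr s b ∧ adj G a b))) ⟩
      xorSum L (λ b → (idM a b ∧ v b) xor ((chr s b ∧ adj G a b) ∧ v b))
    ≡⟨ xorSum-xor L _ _ ⟩
      (idM · v) a xor xorSum L (λ b → (chr s b ∧ adj G a b) ∧ v b)
    ≡⟨ cong₂ _xor_ (idM-· v a)
         (trans (xorSum-cong L (λ b → ∧-assoc (chr s b) (adj G a b) (v b)))
                (Σ₂-chr s (λ b → adj G a b ∧ v b))) ⟩
      v a xor (adj G a s ∧ v s)
    ≡⟨ cong (v a xor_) (∧-comm (adj G a s) (v s)) ⟩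
      v a xor (v s ∧ adj G a s)
    ∎
    where
    open ≡-Reasoning
    L = allFin n

  flipM-involutive : (G : Graph n) (s : Fin n) (v : Vec₂ n) → (flipM G s · (flipM G s · v)) ≈ᵥ v
  flipM-involutive G s v a = begin
      (flipM G s · w) a
    ≡⟨ flipM-· G s w a ⟩
      w a xor (w s ∧ adj G a s)
    ≡⟨ cong₂ (λ x y → x xor (y ∧ adj G a s)) (flipM-· G s v a) w-s ⟩
      (v a xor (v s ∧ adj G a s)) xor (v s ∧ adj G a s)
    ≡⟨ xor-cancelʳ (v a) (v s ∧ adj G a s) ⟩
      v a
    ∎
    where
    open ≡-Reasoning
    w = flipM G s · v
    w-s : w s ≡ v s
    w-s = begin
        w s                        ≡⟨ flipM-· G s v s ⟩
        v s xor (v s ∧ adj G s s)  ≡⟨ cong (λ x → v s xor (v s ∧ x)) (irrefl G s) ⟩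
        v s xor (v s ∧ false)      ≡⟨ cong (v s xor_) (∧-zeroʳ (v s)) ⟩
        v s xor false              ≡⟨ xor-identityʳ (v s) ⟩
        v s                        ∎

data Span {n} {I : Set} (f : I → Vec₂ n) : Vec₂ n → Set where
  span-0    : Span f 0ᵥ
  span-gen  : ∀ i → Span f (f i)
  span-⊕    : ∀ {u v} → Span f u → Span f v → Span f (u ⊕ v)
  span-resp : ∀ {u v} → u ≈ᵥ v → Span f u → Span f v

combination : ∀ {n k} → (Fin k → Vec₂ n) → (Fin k → Bool) → Vec₂ n
combination f c a = Σ₂ (λ i → c i ∧ f i a)

module _ {n} {I : Set} {f : I → Vec₂ n} where

  span-∧ᵥ : ∀ b {v} → (b ≡ true → Span f v) → Span f (b ∧ᵥ v)
  span-∧ᵥ true  v∈ = v∈ refl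
  span-∧ᵥ false _  = span-0

  flipM-preserves-Span : (G : Graph n) (s : Fin n) → Span f (nbhd G s) →
    ∀ {v} → Span f v → Span f (flipM G s · v)
  flipM-preserves-Span G s N∈ {v} v∈ =
    span-resp (≈ᵥ-sym (flipM-· G s v)) (span-⊕ v∈ (span-∧ᵥ (v s) (λ _ → N∈)))

module _ {n k} {f : Fin k → Vec₂ n} where

  combination∈Span : ∀ c → Span f (combination f c)
  combination∈Span c = partial (allFin k)
    where
    partial : ∀ is → Span f (λ a → xorSum is (λ i → c i ∧ f i a))
    partial []       = span-0
    partial (i ∷ is) = span-⊕ (span-∧ᵥ (c i) (λ _ → span-gen i)) (partial is)

  Span⇒combination : ∀ {v} → Span f v → ∃ λ c → v ≈ᵥ combination f c
  Span⇒combination span-0 = (λ _ → false) , λ a → sym (xorSum-false (allFin k))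
  Span⇒combination (span-gen i) = chr i , λ a → sym (Σ₂-chr i (λ j → f j a))
  Span⇒combination (span-⊕ u∈ v∈) with Span⇒combination u∈ | Span⇒combination v∈
  ... | c , u≈ | c′ , v≈ = (λ i → c i xor c′ i) , λ a → begin
      _                                                  ≡⟨ cong₂ _xor_ (u≈ a) (v≈ a) ⟩
      combination f c a xor combination f c′ a           ≡⟨ sym (xorSum-xor (allFin k) _ _) ⟩
      Σ₂ (λ i → (c i ∧ f i a) xor (c′ i ∧ f i a))        ≡⟨ xorSum-cong (allFin k) (λ i → sym (∧-distribʳ-xor (f i a) (c i) (c′ i))) ⟩
      combination f (λ i → c i xor c′ i) a               ∎
    where open ≡-Reasoning
  Span⇒combination (span-resp u≈v u∈) with Span⇒combination u∈
  ... | c , u≈ = c , λ a → trans (sym (u≈v a)) (u≈ a)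

record Stabilises {n} (P : Vec₂ n → Set) (g : Mat₂ n) : Set where
  field
    maps-into : ∀ {v} → P v → P (g · v)
    maps-onto : ∀ {v} → P v → ∃ λ u → P u × ((g · u) ≈ᵥ v)

module _ {n} {P : Vec₂ n → Set} (resp : P Respects _≈ᵥ_) where
  open Stabilises

  idM-stabilises : Stabilises P idM
  idM-stabilises .maps-into {v} v∈ = resp (≈ᵥ-sym (idM-· v)) v∈
  idM-stabilises .maps-onto {v} v∈ = v , v∈ , idM-· v

  ⊗-stabilises : ∀ {g h} → Stabilises P g → Stabilises P h → Stabilises P (g ⊗ h)
  ⊗-stabilises {g} {h} g-stab h-stab .maps-into {v} v∈ =
    resp (≈ᵥ-sym (⊗-· g h v)) (g-stab .maps-into (h-stab .maps-into v∈))
  ⊗-stabilises {g} {h} g-stab h-stab .maps-onto v∈ with g-stab .maps-onto v∈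
  ... | u , u∈ , gu≈v with h-stab .maps-onto u∈
  ...   | w , w∈ , hw≈u = w , w∈ , λ a → trans (⊗-· g h w a) (trans (·-cong g hw≈u a) (gu≈v a))

  left-inverse-stabilises : ∀ {g h} → Stabilises P g → (h ⊗ g) ≈ₘ idM → Stabilises P h
  left-inverse-stabilises {g} {h} g-stab hg≈1 .maps-into v∈ with g-stab .maps-onto v∈
  ... | u , u∈ , gu≈v = resp (λ a → trans (sym (left-inverse-· hg≈1 u a)) (·-cong h gu≈v a)) u∈
  left-inverse-stabilises {g} {h} g-stab hg≈1 .maps-onto {v} v∈ =
    g · v , g-stab .maps-into v∈ , left-inverse-· hg≈1 v

  involution-stabilises : ∀ {g} → (∀ v → (g · (g · v)) ≈ᵥ v) → (∀ {v} → P v → P (g · v)) → Stabilises P g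
  involution-stabilises involutive into .maps-into = into
  involution-stabilises {g} involutive into .maps-onto {v} v∈ = g · v , into v∈ , involutive v

  InW-stabilises : ∀ {G : Graph n} → (∀ s {v} → P v → P (flipM G s · v)) →
    ∀ {g} → InW G g → Stabilises P g
  InW-stabilises flips w-id = idM-stabilises
  InW-stabilises {G} flips (w-gen s) = involution-stabilises (flipM-involutive G s) (flips s)
  InW-stabilises flips (w-mul g∈ h∈) = ⊗-stabilises (InW-stabilises flips g∈) (InW-stabilises flips h∈)
  InW-stabilises flips (w-inv g∈ hg≈1 _) = left-inverse-stabilises (InW-stabilises flips g∈) hg≈1

below : ∀ {n} → ℕ → List (Fin n)
below {n} r = filter (λ j → toℕ j <? r) (allFin n)

applyFlip : ∀ {n} → Graph n → Vec₂ n → Fin n → Vec₂ n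
applyFlip G v j = flipM G j · v

prefixFlips : ∀ {n} → Graph n → ℕ → Vec₂ n
prefixFlips G r = foldl (applyFlip G) bar1 (below r)

filter-<-map-suc : ∀ {n} r (js : List (Fin n)) →
  filter (λ j → toℕ j <? suc r) (map suc js) ≡ map suc (filter (λ j → toℕ j <? r) js)
filter-<-map-suc r []       = refl
filter-<-map-suc r (j ∷ js) with toℕ j <ᵇ r
... | true  = cong (suc j ∷_) (filter-<-map-suc r js)
... | false = filter-<-map-suc r js

below-zero : ∀ {n} → below {n} 0 ≡ []
below-zero = filter-none (λ j → toℕ j <? 0) (tabulate⁺ {f = id} λ _ ())

below-suc-shift : ∀ {n} r → below {suc n} (suc r) ≡ zero ∷ map suc (below {n} r)
below-suc-shift {n} r =
  trans (cong (λ js → filter (λ j → toℕ j <? suc r) (zero ∷ js)) (sym (map-tabulate id suc)))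
        (cong (zero ∷_) (filter-<-map-suc r (allFin n)))

below-suc : ∀ {n} (i : Fin n) → below (suc (toℕ i)) ≡ below (toℕ i) ∷ʳ i
below-suc zero    = begin
    below 1                   ≡⟨ below-suc-shift 0 ⟩
    zero ∷ map suc (below 0)  ≡⟨ cong (λ js → zero ∷ map suc js) below-zero ⟩
    zero ∷ []                 ≡⟨ cong (_∷ʳ zero) (sym below-zero) ⟩
    below 0 ∷ʳ zero           ∎
  where open ≡-Reasoning
below-suc (suc i) = begin
    below (suc (suc (toℕ i)))               ≡⟨ below-suc-shift (suc (toℕ i)) ⟩
    zero ∷ map suc (below (suc (toℕ i)))    ≡⟨ cong (λ js → zero ∷ map suc js) (below-suc i) ⟩
    zero ∷ map suc (below (toℕ i) ∷ʳ i)     ≡⟨ cong (zero ∷_) (map-++ suc (below (toℕ i)) _) ⟩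
    zero ∷ map suc (below (toℕ i)) ∷ʳ suc i ≡⟨ cong (_∷ʳ suc i) (sym (below-suc-shift (toℕ i))) ⟩
    below (suc (toℕ i)) ∷ʳ suc i            ∎
  where open ≡-Reasoning

prefixFlips-zero : ∀ {n} (G : Graph n) → prefixFlips G 0 ≡ bar1
prefixFlips-zero G = cong (foldl (applyFlip G) bar1) below-zero

prefixFlips-step : ∀ {n} (G : Graph n) (s : Fin n) →
  prefixFlips G (suc (toℕ s)) ≈ᵥ prefixFlips G (toℕ s) ⊕ prefixFlips G (toℕ s) s ∧ᵥ nbhd G s
prefixFlips-step G s a = begin
    prefixFlips G (suc (toℕ s)) a
  ≡⟨ cong (λ js → foldl (applyFlip G) bar1 js a) (below-suc s) ⟩
    foldl (applyFlip G) bar1 (below (toℕ s) ∷ʳ s) a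
  ≡⟨ cong (λ v → v a) (foldl-∷ʳ (applyFlip G) bar1 s (below (toℕ s))) ⟩
    (flipM G s · prefixFlips G (toℕ s)) a
  ≡⟨ flipM-· G s (prefixFlips G (toℕ s)) a ⟩
    (prefixFlips G (toℕ s) ⊕ prefixFlips G (toℕ s) s ∧ᵥ nbhd G s) a
  ∎
  where open ≡-Reasoning

chr-self : ∀ {n} (s : Fin n) → chr s s ≡ true
chr-self s with s ≟ s
... | yes _   = refl
... | no  s≢s = ⊥-elim (s≢s refl)

chr-≢ : ∀ {n} {s a : Fin n} → a ≢ s → chr s a ≡ false
chr-≢ {s = s} {a} a≢s with a ≟ s
... | yes a≡s = ⊥-elim (a≢s a≡s)
... | no  _   = refl

edgeIndicator : ℕ → ℕ → Bool
edgeIndicator r i = (suc i ≡ᵇ r) xor (i ≡ᵇ r)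

edgeIndicator-diagonal : ∀ r → edgeIndicator r r ≡ true
edgeIndicator-diagonal zero    = refl
edgeIndicator-diagonal (suc r) = edgeIndicator-diagonal r

edgeIndicator-suc : ∀ r i →
  edgeIndicator r i xor ((i ≡ᵇ suc r) xor (suc i ≡ᵇ r)) ≡ edgeIndicator (suc r) i
edgeIndicator-suc r i =
  solve 3 (λ x y z → (x :+ y) :+ (z :+ x) := y :+ z) refl (suc i ≡ᵇ r) (i ≡ᵇ r) (i ≡ᵇ suc r)

<ᵇ-suc-∧ : ∀ (f : ℕ → Bool) x r → (x <ᵇ suc r) ∧ f x ≡ ((x <ᵇ r) ∧ f x) xor (f r ∧ (x ≡ᵇ r))
<ᵇ-suc-∧ f zero    zero    = sym (∧-identityʳ (f 0))
<ᵇ-suc-∧ f zero    (suc r) = sym (trans (cong (f 0 xor_) (∧-zeroʳ (f (suc r)))) (xor-identityʳ (f 0)))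
<ᵇ-suc-∧ f (suc x) zero    = sym (∧-zeroʳ (f 0))
<ᵇ-suc-∧ f (suc x) (suc r) = <ᵇ-suc-∧ (f ∘ suc) x r

module PathWithApex {ℓ : ℕ} (G : Graph (suc ℓ)) (path : InducedPathPrefix G) where

  U : Vec₂ (suc ℓ) → Set
  U = Span (Πvec G)

  apex : Fin (suc ℓ)
  apex = fromℕ ℓ

  vertex-view : (a : Fin (suc ℓ)) → toℕ a < ℓ ⊎ a ≡ apex
  vertex-view a with m≤n⇒m<n∨m≡n (s≤s⁻¹ (toℕ<n a))
  ... | inj₁ a<ℓ = inj₁ a<ℓ
  ... | inj₂ a≡ℓ = inj₂ (toℕ-injective (trans a≡ℓ (sym (toℕ-fromℕ ℓ))))

  onPath⇒≢apex : ∀ {a} → toℕ a < ℓ → a ≢ apex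
  onPath⇒≢apex a<ℓ refl = <⇒≢ a<ℓ (toℕ-fromℕ ℓ)

  ≈ᵥ-onPath-apex : ∀ {u v : Vec₂ (suc ℓ)} →
    (∀ a → toℕ a < ℓ → u a ≡ v a) → u apex ≡ v apex → u ≈ᵥ v
  ≈ᵥ-onPath-apex onPath atApex a with vertex-view a
  ... | inj₁ a<ℓ  = onPath a a<ℓ
  ... | inj₂ refl = atApex

  edge-onPath : ∀ a b → toℕ a < ℓ → toℕ b < ℓ →
    adj G a b ≡ (toℕ a ≡ᵇ suc (toℕ b)) xor (suc (toℕ a) ≡ᵇ toℕ b)
  edge-onPath a b a<ℓ b<ℓ with path a b a<ℓ b<ℓ | adj G a b in e
  ... | only-if , _ | true with only-if e
  ...   | inj₁ a≡1+b = sym (cong₂ _xor_ (≡ᵇ-true a≡1+b)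
                                        (≡ᵇ-false λ 1+a≡b → <-asym (≤-reflexive 1+a≡b) (≤-reflexive (sym a≡1+b))))
  ...   | inj₂ b≡1+a = sym (cong₂ _xor_ (≡ᵇ-false λ a≡1+b → <-asym (≤-reflexive (sym b≡1+a)) (≤-reflexive (sym a≡1+b)))
                                        (≡ᵇ-true (sym b≡1+a)))
  edge-onPath a b a<ℓ b<ℓ | _ , if | false =
    sym (cong₂ _xor_ (≡ᵇ-false (non-edge ∘ inj₁)) (≡ᵇ-false (non-edge ∘ inj₂ ∘ sym)))
    where
    non-edge : ¬ (toℕ a ≡ suc (toℕ b) ⊎ toℕ b ≡ suc (toℕ a))
    non-edge p with trans (sym e) (if p)
    ... | ()

  -- bar r is \overline{r+1}.
  bar : ℕ → Vec₂ (suc ℓ)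
  bar = prefixFlips G

  bar∈U : ∀ {r} → r ≤ ℓ → U (bar r)
  bar∈U r≤ℓ = subst (U ∘ bar) (toℕ-fromℕ< (s≤s r≤ℓ)) (span-gen (fromℕ< (s≤s r≤ℓ)))

  BarOnPath : ℕ → Set
  BarOnPath r = ∀ a → toℕ a < ℓ → bar r a ≡ edgeIndicator r (toℕ a)

  bar-onPath-step : ∀ (s : Fin (suc ℓ)) {r} → toℕ s ≡ r → r < ℓ → BarOnPath r → BarOnPath (suc r)
  bar-onPath-step s refl s<ℓ ih a a<ℓ = begin
      bar (suc r) a
    ≡⟨ prefixFlips-step G s a ⟩
      bar r a xor (bar r s ∧ adj G a s)
    ≡⟨ cong₂ (λ x y → x xor (y ∧ adj G a s)) (ih a a<ℓ) (trans (ih s s<ℓ) (edgeIndicator-diagonal r)) ⟩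
      edgeIndicator r (toℕ a) xor adj G a s
    ≡⟨ cong (edgeIndicator r (toℕ a) xor_) (edge-onPath a s a<ℓ s<ℓ) ⟩
      edgeIndicator r (toℕ a) xor ((toℕ a ≡ᵇ suc r) xor (suc (toℕ a) ≡ᵇ r))
    ≡⟨ edgeIndicator-suc r (toℕ a) ⟩
      edgeIndicator (suc r) (toℕ a)
    ∎
    where
    open ≡-Reasoning
    r = toℕ s

  bar-onPath : ∀ r → r ≤ ℓ → BarOnPath r
  bar-onPath zero    _   a _ = cong (λ v → v a) (prefixFlips-zero G)
  bar-onPath (suc r) r<ℓ   =
    bar-onPath-step (fromℕ< (m<n⇒m<1+n r<ℓ)) (toℕ-fromℕ< _) r<ℓ (bar-onPath r (<⇒≤ r<ℓ))

  bar-diagonal : ∀ s → toℕ s < ℓ → bar (toℕ s) s ≡ true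
  bar-diagonal s s<ℓ = trans (bar-onPath (toℕ s) (<⇒≤ s<ℓ) s s<ℓ) (edgeIndicator-diagonal (toℕ s))

  bar-difference : ∀ s → toℕ s < ℓ → bar (toℕ s) ⊕ bar (suc (toℕ s)) ≈ᵥ nbhd G s
  bar-difference s s<ℓ a = begin
      bar (toℕ s) a xor bar (suc (toℕ s)) a
    ≡⟨ cong (bar (toℕ s) a xor_) (prefixFlips-step G s a) ⟩
      bar (toℕ s) a xor (bar (toℕ s) a xor (bar (toℕ s) s ∧ adj G a s))
    ≡⟨ xor-cancelˡ (bar (toℕ s) a) _ ⟩
      bar (toℕ s) s ∧ adj G a s
    ≡⟨ cong (_∧ adj G a s) (bar-diagonal s s<ℓ) ⟩
      adj G a s
    ∎
    where open ≡-Reasoning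

  d : ℕ → Bool
  d r = bar r apex

  c : ℕ → Bool
  c r = d r xor d (suc r)

  c-onPath : ∀ s → toℕ s < ℓ → c (toℕ s) ≡ adj G s apex
  c-onPath s s<ℓ = trans (bar-difference s s<ℓ apex) (Graph.sym G apex s)

  barSum : ℕ → Vec₂ (suc ℓ)
  barSum zero    = bar zero
  barSum (suc r) = barSum r ⊕ bar (suc r)

  dSum : ℕ → Bool
  dSum zero    = false
  dSum (suc r) = dSum r xor d r

  barSum∈U : ∀ r → r ≤ ℓ → U (barSum r)
  barSum∈U zero    r≤ℓ = bar∈U r≤ℓ
  barSum∈U (suc r) r<ℓ = span-⊕ (barSum∈U r (<⇒≤ r<ℓ)) (bar∈U r<ℓ)

  barSum-onPath : ∀ r → r ≤ ℓ → ∀ a → toℕ a < ℓ → barSum r a ≡ (toℕ a ≡ᵇ r)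
  barSum-onPath zero    r≤ℓ a a<ℓ = bar-onPath zero r≤ℓ a a<ℓ
  barSum-onPath (suc r) r<ℓ a a<ℓ =
    trans (cong₂ _xor_ (barSum-onPath r (<⇒≤ r<ℓ) a a<ℓ) (bar-onPath (suc r) r<ℓ a a<ℓ))
          (xor-cancelˡ (toℕ a ≡ᵇ r) (toℕ a ≡ᵇ suc r))

  barSum-apex : ∀ r → barSum r apex ≡ dSum (suc r)
  barSum-apex zero    = refl
  barSum-apex (suc r) = cong (_xor d (suc r)) (barSum-apex r)

  partialNbhd : ℕ → Vec₂ (suc ℓ)
  partialNbhd zero    = 0ᵥ
  partialNbhd (suc r) = partialNbhd r ⊕ c r ∧ᵥ barSum r

  partialNbhd∈U : ∀ r → r ≤ ℓ → U (partialNbhd r)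
  partialNbhd∈U zero    _   = span-0
  partialNbhd∈U (suc r) r<ℓ =
    span-⊕ (partialNbhd∈U r (<⇒≤ r<ℓ)) (span-∧ᵥ (c r) (λ _ → barSum∈U r (<⇒≤ r<ℓ)))

  partialNbhd-onPath : ∀ r → r ≤ ℓ → ∀ a → toℕ a < ℓ → partialNbhd r a ≡ (toℕ a <ᵇ r) ∧ c (toℕ a)
  partialNbhd-onPath zero    _   a a<ℓ = refl
  partialNbhd-onPath (suc r) r<ℓ a a<ℓ =
    trans (cong₂ (λ x y → x xor (c r ∧ y)) (partialNbhd-onPath r (<⇒≤ r<ℓ) a a<ℓ)
                                           (barSum-onPath r (<⇒≤ r<ℓ) a a<ℓ))
          (sym (<ᵇ-suc-∧ c (toℕ a) r))

  partialNbhd-apex : ∀ r → partialNbhd r apex ≡ not (d r) ∧ dSum r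
  partialNbhd-apex zero    = sym (∧-zeroʳ (not (d zero)))
  partialNbhd-apex (suc r) =
    trans (cong₂ (λ x y → x xor (c r ∧ y)) (partialNbhd-apex r) (barSum-apex r))
          (step-identity (d r) (d (suc r)) (dSum r))
    where
    step-identity : ∀ x y z → (not x ∧ z) xor ((x xor y) ∧ (z xor x)) ≡ not y ∧ (z xor x)
    step-identity false false false = refl
    step-identity false false true  = refl
    step-identity false true  false = refl
    step-identity false true  true  = refl
    step-identity true  false false = refl
    step-identity true  false true  = refl
    step-identity true  true  false = refl
    step-identity true  true  true  = refl

  chr-apex∈U : not (d ℓ) ∧ dSum ℓ ≡ true → U (chr apex)
  chr-apex∈U coefficient≡1 = span-resp barSum≈chr (barSum∈U ℓ ≤-refl)
    where
    not-∧-true⇒xor-true : ∀ x y → not x ∧ y ≡ true → y xor x ≡ true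
    not-∧-true⇒xor-true false true  _ = refl
    not-∧-true⇒xor-true false false ()
    not-∧-true⇒xor-true true  _     ()
    barSum≈chr : barSum ℓ ≈ᵥ chr apex
    barSum≈chr = ≈ᵥ-onPath-apex
      (λ a a<ℓ → trans (barSum-onPath ℓ ≤-refl a a<ℓ)
                       (trans (≡ᵇ-false (<⇒≢ a<ℓ)) (sym (chr-≢ (onPath⇒≢apex a<ℓ)))))
      (trans (barSum-apex ℓ) (trans (not-∧-true⇒xor-true (d ℓ) (dSum ℓ) coefficient≡1) (sym (chr-self apex))))

  nbhd-apex : nbhd G apex ≈ᵥ partialNbhd ℓ ⊕ partialNbhd ℓ apex ∧ᵥ chr apex
  nbhd-apex = ≈ᵥ-onPath-apex onPath atApex
    where
    μ = partialNbhd ℓ apex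
    onPath : ∀ a → toℕ a < ℓ → adj G a apex ≡ partialNbhd ℓ a xor (μ ∧ chr apex a)
    onPath a a<ℓ = sym (begin
        partialNbhd ℓ a xor (μ ∧ chr apex a)
      ≡⟨ cong₂ (λ x y → x xor (μ ∧ y)) (partialNbhd-onPath ℓ ≤-refl a a<ℓ) (chr-≢ (onPath⇒≢apex a<ℓ)) ⟩
        ((toℕ a <ᵇ ℓ) ∧ c (toℕ a)) xor (μ ∧ false)
      ≡⟨ cong₂ (λ x y → (x ∧ c (toℕ a)) xor y) (<ᵇ-true a<ℓ) (∧-zeroʳ μ) ⟩
        c (toℕ a) xor false
      ≡⟨ xor-identityʳ (c (toℕ a)) ⟩
        c (toℕ a)
      ≡⟨ c-onPath a a<ℓ ⟩
        adj G a apex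
      ∎)
      where open ≡-Reasoning
    atApex : adj G apex apex ≡ μ xor (μ ∧ chr apex apex)
    atApex = begin
      adj G apex apex            ≡⟨ irrefl G apex ⟩
      false                      ≡⟨ sym (xor-same μ) ⟩
      μ xor μ                    ≡⟨ cong (μ xor_) (sym (trans (cong (μ ∧_) (chr-self apex)) (∧-identityʳ μ))) ⟩
      μ xor (μ ∧ chr apex apex)  ∎
      where open ≡-Reasoning

  nbhd∈U : ∀ s → U (nbhd G s)
  nbhd∈U s with vertex-view s
  ... | inj₁ s<ℓ  = span-resp (bar-difference s s<ℓ) (span-⊕ (bar∈U (<⇒≤ s<ℓ)) (bar∈U s<ℓ))
  ... | inj₂ refl = span-resp (≈ᵥ-sym nbhd-apex)
    (span-⊕ (partialNbhd∈U ℓ ≤-refl)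
            (span-∧ᵥ (partialNbhd ℓ apex) (λ μ≡1 → chr-apex∈U (trans (sym (partialNbhd-apex ℓ)) μ≡1))))

corollary3p6 : (n : ℕ) → 2 ≤ n → (G : Graph n) → Connected G → InducedPathPrefix G
    → (g : Mat₂ n) → InW G g → (v : Vec₂ n) → InSpanΠ G v → InSpanΠ G (g · v)
corollary3p6 (suc ℓ) _ G _ path g g∈W v (c , v≈c) =
  Span⇒combination (Stabilises.maps-into W-stabilises-U v∈U)
  where
  open PathWithApex G path using (U; nbhd∈U)
  v∈U : U v
  v∈U = span-resp (≈ᵥ-sym v≈c) (combination∈Span c)
  W-stabilises-U : Stabilises U g
  W-stabilises-U = InW-stabilises span-resp (λ s → flipM-preserves-Span G s (nbhd∈U s)) g∈W
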